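{- $\mathbb{P}(L_3)$ does not satisfy idempotency: there exists $\Gamma\subseteq For$ with $Cn^{\mathbb{P}}_{L_3}(Cn^{\mathbb{P}}_{L_3}(\Gamma))\neq Cn^{\mathbb{P}}_{L_3}(\Gamma)$.
   Context: $For$ is the set of formulas built from a countable set $Prop$ of propositional letters with $\neg,\vee,\wedge,\rightarrow$. $L_3$ (Łukasiewicz) is given by the matrix with truth values $\{0,1/2,1\}$, designated set $\{1\}$, $f_\neg(x)=1-x$, $f_\vee=\max$, $f_\wedge=\min$, $f_\rightarrow(x,y)=\min\{1,1-x+y\}$; valuations are maps $Prop\to\{0,1/2,1\}$ extended via these functions. $\Gamma\vDash_{L_3}\alpha$ iff every valuation giving all members of $\Gamma$ value $1$ gives $\alpha$ value $1$; $\Gamma$ is $L_3$-consistent iff $\{\alpha:\Gamma\vDash_{L_3}\alpha\}\neq For$. $\Gamma\vDash^{\mathbb{P}}_{L_3}\alpha$ iff there exists an $L_3$-consistent $\Gamma'\subseteq\Gamma$ with $\Gamma'\vDash_{L_3}\alpha$; $Cn^{\mathbb{P}}_{L_3}(\Gamma)=\{\alpha:\Gamma\vDash^{\mathbb{P}}_{L_3}\alpha\}$. -}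

module Defs where

open import Level using (Level) renaming (suc to lsuc; _⊔_ to _⊔ˡ_; zero to lzero)

open import Data.Nat using (ℕ; _⊔_; _⊓_; _∸_; _+_)
open import Data.Fin using (Fin; toℕ; fromℕ<)
open import Data.Product using (Σ; _×_)
open import Relation.Binary.PropositionalEquality using (_≡_)
open import Relation.Nullary using (¬_)
open import Data.Nat.Properties using (m⊓n≤m; ≤-<-trans)
open import Data.Nat using (_<_; s≤s; z≤n)

Prop : Set
Prop = ℕ

data For : Set where
  var : Prop → For
  ¬'_ : For → For
  _∨'_ : For → For → For
  _∧'_ : For → For → For
  _⇒'_ : For → For → For

-- Truth values {0, 1/2, 1} of L₃, represented by their doubles: Fin 3 = {0,1,2}
-- where k : Fin 3 stands for k/2.
V : Set
V = Fin 3

private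
  cap : ℕ → V
  cap n = fromℕ< {n ⊓ 2} (≤-<-trans (Data.Nat.Properties.m⊓n≤n n 2) (s≤s (s≤s (s≤s z≤n))))

-- Truth functions (on doubled values):
-- f¬(x) = 1 - x ; f∨ = max ; f∧ = min ; f→(x,y) = min{1, 1 - x + y}
f¬ : V → V
f¬ x = cap (2 ∸ toℕ x)

f∨ : V → V → V
f∨ x y = cap (toℕ x ⊔ toℕ y)

f∧ : V → V → V
f∧ x y = cap (toℕ x ⊓ toℕ y)

f⇒ : V → V → V
f⇒ x y = cap ((2 ∸ toℕ x) + toℕ y)

Valuation : Set
Valuation = Prop → V

⟦_⟧ : For → Valuation → V
⟦ var p ⟧ v = v p
⟦ ¬' α ⟧ v = f¬ (⟦ α ⟧ v)
⟦ α ∨' β ⟧ v = f∨ (⟦ α ⟧ v) (⟦ β ⟧ v)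
⟦ α ∧' β ⟧ v = f∧ (⟦ α ⟧ v) (⟦ β ⟧ v)
⟦ α ⇒' β ⟧ v = f⇒ (⟦ α ⟧ v) (⟦ β ⟧ v)

one : V
one = cap 2

-- Sets of formulas as predicates (level-polymorphic, since Cn^P raises the level).
FSet : (ℓ : Level) → Set (lsuc ℓ)
FSet ℓ = For → Set ℓ

_⊆_ : ∀ {ℓ ℓ'} → FSet ℓ → FSet ℓ' → Set (ℓ ⊔ˡ ℓ')
A ⊆ B = ∀ α → A α → B α

_≐_ : ∀ {ℓ ℓ'} → FSet ℓ → FSet ℓ' → Set (ℓ ⊔ˡ ℓ')
A ≐ B = (A ⊆ B) × (B ⊆ A)

_⊨_ : ∀ {ℓ} → FSet ℓ → For → Set ℓ
Γ ⊨ α = (v : Valuation) → (∀ β → Γ β → ⟦ β ⟧ v ≡ one) → ⟦ α ⟧ v ≡ one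

Consistent : ∀ {ℓ} → FSet ℓ → Set ℓ
Consistent Γ = Σ For (λ α → ¬ (Γ ⊨ α))

_⊨ᴾ_ : ∀ {ℓ} → FSet ℓ → For → Set (lsuc ℓ)
_⊨ᴾ_ {ℓ} Γ α = Σ (FSet ℓ) (λ Γ' → (Γ' ⊆ Γ) × Consistent Γ' × (Γ' ⊨ α))

CnP : ∀ {ℓ} → FSet ℓ → FSet (lsuc ℓ)
CnP Γ α = Γ ⊨ᴾ α

-- Take Γ = {p, ¬p ∧ q}. Each member is satisfiable on its own, so p and q
-- lie in Cn^P(Γ); the consistent set {p, q} then puts p ∧ q into
-- Cn^P(Cn^P(Γ)). But a subset of Γ entailing p ∧ q must contain both members
-- (otherwise a valuation making only p, resp. only q, true refutes it), and
-- p, ¬p ∧ q are jointly unsatisfiable, so p ∧ q ∉ Cn^P(Γ).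
module Submission where

open import Defs
open import Level using (Level) renaming (zero to lzero)
open import Data.Product using (Σ; _,_; proj₁)
open import Data.Nat using (zero; suc)
open import Data.Fin using () renaming (zero to fz; suc to fs)
open import Data.Empty using (⊥-elim)
open import Function using (_∘_)
open import Relation.Nullary using (¬_)
open import Relation.Binary.PropositionalEquality using (_≡_; _≢_; refl; cong₂)

private
  variable
    ℓ : Level
    α β : For

f⇒-refl : ∀ x → f⇒ x x ≡ one
f⇒-refl fz = refl
f⇒-refl (fs fz) = refl
f⇒-refl (fs (fs fz)) = refl

f∧-oneʳ : ∀ x y → f∧ x y ≡ one → y ≡ one
f∧-oneʳ x (fs (fs fz)) _ = refl
f∧-oneʳ fz fz ()
f∧-oneʳ fz (fs fz) ()
f∧-oneʳ (fs fz) fz ()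
f∧-oneʳ (fs fz) (fs fz) ()
f∧-oneʳ (fs (fs fz)) fz ()
f∧-oneʳ (fs (fs fz)) (fs fz) ()

f∧-f¬-one : ∀ x y → x ≡ one → f∧ (f¬ x) y ≢ one
f∧-f¬-one _ fz refl ()
f∧-f¬-one _ (fs fz) refl ()
f∧-f¬-one _ (fs (fs fz)) refl ()

_⊩_ : Valuation → FSet ℓ → Set ℓ
v ⊩ Γ = ∀ β → Γ β → ⟦ β ⟧ v ≡ one

falsum : For
falsum = ¬' (var 0 ⇒' var 0)

⟦falsum⟧≢one : ∀ v → ⟦ falsum ⟧ v ≢ one
⟦falsum⟧≢one v eq with ⟦ var 0 ⇒' var 0 ⟧ v | f⇒-refl (v 0)
⟦falsum⟧≢one v () | _ | refl

countermodel : ∀ {Γ : FSet ℓ} α v → v ⊩ Γ → ⟦ α ⟧ v ≢ one → ¬ (Γ ⊨ α)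
countermodel _ v v⊩Γ α-fails Γ⊨α = α-fails (Γ⊨α v v⊩Γ)

satisfiable⇒consistent : ∀ {Γ : FSet ℓ} v → v ⊩ Γ → Consistent Γ
satisfiable⇒consistent v v⊩Γ = falsum , countermodel falsum v v⊩Γ (⟦falsum⟧≢one v)

⊨-∧-elimʳ : ∀ {Γ : FSet ℓ} α β → Γ ⊨ (α ∧' β) → Γ ⊨ β
⊨-∧-elimʳ α β Γ⊨α∧β v v⊩Γ = f∧-oneʳ (⟦ α ⟧ v) (⟦ β ⟧ v) (Γ⊨α∧β v v⊩Γ)

¬-∧-inconsistent : {Γ : FSet ℓ} → Γ α → Γ ((¬' α) ∧' β) → ¬ Consistent Γ
¬-∧-inconsistent {α = α} {β} α∈Γ ¬α∧β∈Γ (_ , Γ⊭γ) = Γ⊭γ λ v v⊩Γ →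
  ⊥-elim (f∧-f¬-one (⟦ α ⟧ v) (⟦ β ⟧ v) (v⊩Γ _ α∈Γ) (v⊩Γ _ ¬α∧β∈Γ))

⊨ᴾ-of-satisfiable : ∀ {Γ : FSet ℓ} Δ α v → Δ ⊆ Γ → v ⊩ Δ → Δ ⊨ α → Γ ⊨ᴾ α
⊨ᴾ-of-satisfiable Δ _ v Δ⊆Γ v⊩Δ Δ⊨α = Δ , Δ⊆Γ , satisfiable⇒consistent v v⊩Δ , Δ⊨α

⊨-singleton : ∀ α → (_≡ α) ⊨ α
⊨-singleton _ v v⊩α = v⊩α _ refl

data Pair {ℓ} (α β : For) : FSet ℓ where
  left : Pair α β α
  right : Pair α β β

Pair⊨∧ : ∀ α β → Pair {ℓ} α β ⊨ (α ∧' β)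
Pair⊨∧ α β v v⊩αβ = cong₂ f∧ (v⊩αβ α left) (v⊩αβ β right)

⊩-⊆Pair : ∀ {ℓ'} {Δ : FSet ℓ} v → Δ ⊆ Pair {ℓ'} α β →
          (Δ α → ⟦ α ⟧ v ≡ one) → (Δ β → ⟦ β ⟧ v ≡ one) → v ⊩ Δ
⊩-⊆Pair v Δ⊆αβ α-true β-true γ γ∈Δ with Δ⊆αβ γ γ∈Δ
... | left = α-true γ∈Δ
... | right = β-true γ∈Δ

p q : For
p = var 0
q = var 1

all-true only-p only-q : Valuation
all-true _ = one
only-p zero = one
only-p (suc _) = fz
only-q zero = fz
only-q (suc _) = one

Γ₀ : FSet lzero
Γ₀ = Pair p ((¬' p) ∧' q)

p∈CnPΓ₀ : CnP Γ₀ p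
p∈CnPΓ₀ = ⊨ᴾ-of-satisfiable (_≡ p) p all-true
  (λ { _ refl → left }) (λ { _ refl → refl }) (⊨-singleton p)

q∈CnPΓ₀ : CnP Γ₀ q
q∈CnPΓ₀ = ⊨ᴾ-of-satisfiable (_≡ (¬' p) ∧' q) q only-q
  (λ { _ refl → right }) (λ { _ refl → refl }) (⊨-∧-elimʳ (¬' p) q (⊨-singleton ((¬' p) ∧' q)))

p∧q∈CnPCnPΓ₀ : CnP (CnP Γ₀) (p ∧' q)
p∧q∈CnPCnPΓ₀ = ⊨ᴾ-of-satisfiable (Pair p q) (p ∧' q) all-true
  (λ { _ left → p∈CnPΓ₀ ; _ right → q∈CnPΓ₀ })
  (λ { _ left → refl ; _ right → refl })
  (Pair⊨∧ p q)

p∧q∉CnPΓ₀ : ¬ CnP Γ₀ (p ∧' q)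
p∧q∉CnPΓ₀ (Δ , Δ⊆Γ₀ , Δ-consistent , Δ⊨p∧q) =
  p∈Δ λ p∈Δ → ¬p∧q∈Δ λ ¬p∧q∈Δ → ¬-∧-inconsistent p∈Δ ¬p∧q∈Δ Δ-consistent
  where
  -- Membership in Δ is undecidable, but the goal is ⊥, so refuting each
  -- absence is enough.
  p∈Δ : ¬ ¬ Δ p
  p∈Δ p∉Δ = countermodel (p ∧' q) only-q
    (⊩-⊆Pair only-q Δ⊆Γ₀ (⊥-elim ∘ p∉Δ) (λ _ → refl)) (λ ()) Δ⊨p∧q

  ¬p∧q∈Δ : ¬ ¬ Δ ((¬' p) ∧' q)
  ¬p∧q∈Δ ¬p∧q∉Δ = countermodel (p ∧' q) only-p
    (⊩-⊆Pair only-p Δ⊆Γ₀ (λ _ → refl) (⊥-elim ∘ ¬p∧q∉Δ)) (λ ()) Δ⊨p∧q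

corollary9 : Σ (FSet lzero) (λ Γ → ¬ (CnP (CnP Γ) ≐ CnP Γ))
corollary9 = Γ₀ , λ CnPCnPΓ₀≐CnPΓ₀ →
  p∧q∉CnPΓ₀ (proj₁ CnPCnPΓ₀≐CnPΓ₀ (p ∧' q) p∧q∈CnPCnPΓ₀)
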